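{- Let $n\in\mathbb{D}$ be squarefree with $n\equiv 1\pmod 4$, and let $L\subset\mathbb{Z}^4$ be a primitive two-dimensional sublattice with $\operatorname{disc}(Q_L)=-4n$. For $i=1,2$, the image of the linear map $\mu_i: L\otimes L^{\perp}\to\mathbf{B}_0(\mathbb{Z})$ is the two-dimensional lattice $M_i$, and $(M_i,Q_{M_i})$ is a Legendre composition of $(L,Q_L)$ and $(L^{\perp},Q_{L^{\perp}})$.
   Context: $\mathbb{D}=\{D\in\mathbb{N}:D\not\equiv 0,7,12,15\pmod{16}\}$. A two-dimensional sublattice $L\subset\mathbb{Z}^4$ is primitive if $(\mathbb{Q}L)\cap\mathbb{Z}^4=L$; $L^\perp=\{w\in\mathbb{Z}^4:\langle w,x\rangle=0\ \forall x\in L\}$ for the standard inner product. For a sublattice $N$, $Q_N$ is the restriction of the sum-of-squares form to $N$, and $\operatorname{disc}(Q_L)$ is $-4$ times the determinant of its Gram matrix. Identify $\mathbb{Z}^4$ with the integral Hamilton quaternions $\mathbf{B}(\mathbb{Z})$ via $(a,b,c,d)\mapsto a+b\mathbf{i}+c\mathbf{j}+d\mathbf{k}$, with conjugation $x\mapsto\bar x$, trace $\operatorname{Tr}(x)=x+\bar x$ and norm $\operatorname{Nr}(x)=x\bar x$ (the sum-of-squares form); $\mathbf{B}_0(\mathbb{Z})$ denotes trace-zero integral quaternions, identified with $\mathbb{Z}^3$ via $x\mathbf{i}+y\mathbf{j}+z\mathbf{k}\mapsto(x,y,z)$. For $L=\langle u,v\rangle$ (a $\mathbb{Z}$-basis)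 put $a_1(L)=u\bar v-\tfrac12\operatorname{Tr}(u\bar v)$ and $a_2(L)=\bar v u-\tfrac12\operatorname{Tr}(\bar v u)$, and $M_i=a_i(L)^{\perp}\subset\mathbb{Z}^3$ (orthogonal complement in $\mathbb{Z}^3$ for the standard inner product), with $Q_{M_i}$ the restriction of $x^2+y^2+z^2$. Define $\mu_1(v\otimes w)=v\bar w$ and $\mu_2(v\otimes w)=\bar v w$ for $v\in L$, $w\in L^\perp$, extended linearly. A binary quadratic lattice $(M,q_M)$ (a rank-2 lattice with integer-valued quadratic form) is a Legendre composition of binary quadratic lattices $(L,q_L)$, $(L',q_{L'})$ if there is a surjective linear homomorphism $\mu:L\otimes L'\to M$ with $q_L(u)q_{L'}(v)=q_M(\mu(u\otimes v))$ for all $u\in L,v\in L'$. -}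

module Defs where

open import Data.Nat as ℕ using (ℕ; _%_)
open import Data.Nat.Divisibility using (_∣_)
open import Data.Integer as ℤ using (ℤ; +_; _+_; _*_; _-_; -_)
open import Data.Product using (Σ; _×_)
open import Relation.Binary.PropositionalEquality using (_≡_; _≢_)
open import Relation.Nullary using (¬_)

InD : ℕ → Set
InD n = ¬ (n % 16 ≡ 0) × ¬ (n % 16 ≡ 7) × ¬ (n % 16 ≡ 12) × ¬ (n % 16 ≡ 15)

SquareFree : ℕ → Set
SquareFree n = ∀ d → (d ℕ.* d) ∣ n → d ≡ 1

-- ℤ⁴ = integral Hamilton quaternions, ℤ³ = trace-zero quaternions

record Q4 : Set where
  constructor q4
  field
    re ii jj kk : ℤ
open Q4 public

record Q3 : Set where
  constructor v3
  field
    x y z : ℤ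
open Q3 public

infixl 6 _+₄_ _+₃_
_+₄_ : Q4 → Q4 → Q4
q4 a b c d +₄ q4 a' b' c' d' = q4 (a + a') (b + b') (c + c') (d + d')

_·₄_ : ℤ → Q4 → Q4
k ·₄ q4 a b c d = q4 (k * a) (k * b) (k * c) (k * d)

_+₃_ : Q3 → Q3 → Q3
v3 a b c +₃ v3 a' b' c' = v3 (a + a') (b + b') (c + c')

-₃_ : Q3 → Q3
-₃ v3 a b c = v3 (- a) (- b) (- c)

0₃ : Q3
0₃ = v3 (+ 0) (+ 0) (+ 0)

dot₄ : Q4 → Q4 → ℤ
dot₄ (q4 a b c d) (q4 a' b' c' d') = a * a' + b * b' + c * c' + d * d'

dot₃ : Q3 → Q3 → ℤ
dot₃ (v3 a b c) (v3 a' b' c') = a * a' + b * b' + c * c'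

nr₄ : Q4 → ℤ
nr₄ u = dot₄ u u

nr₃ : Q3 → ℤ
nr₃ m = dot₃ m m

conj : Q4 → Q4
conj (q4 a b c d) = q4 a (- b) (- c) (- d)

_⊛_ : Q4 → Q4 → Q4
q4 a₁ b₁ c₁ d₁ ⊛ q4 a₂ b₂ c₂ d₂ =
  q4 (a₁ * a₂ - b₁ * b₂ - c₁ * c₂ - d₁ * d₂)
     (a₁ * b₂ + b₁ * a₂ + c₁ * d₂ - d₁ * c₂)
     (a₁ * c₂ - b₁ * d₂ + c₁ * a₂ + d₁ * b₂)
     (a₁ * d₂ + b₁ * c₂ - c₁ * b₂ + d₁ * a₂)

-- x - ½ Tr(x) for x ∈ 𝐁(ℤ) (Tr x = 2 re x), viewed in 𝐁₀(ℤ) = ℤ³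
pure : Q4 → Q3
pure (q4 a b c d) = v3 b c d

InL : Q4 → Q4 → Q4 → Set
InL u v w = Σ ℤ λ a → Σ ℤ λ b → w ≡ (a ·₄ u) +₄ (b ·₄ v)

Primitive : Q4 → Q4 → Set
Primitive u v = ∀ (k : ℤ) (w : Q4) → k ≢ + 0 → InL u v (k ·₄ w) → InL u v w

InPerp : Q4 → Q4 → Q4 → Set
InPerp u v w = ∀ t → InL u v t → dot₄ w t ≡ + 0

disc : Q4 → Q4 → ℤ
disc u v = - (+ 4) * (nr₄ u * nr₄ v - dot₄ u v * dot₄ u v)

data Idx : Set where
  one two : Idx

aL : Idx → Q4 → Q4 → Q3
aL one u v = pure (u ⊛ conj v)
aL two u v = pure (conj v ⊛ u)

InM : Idx → Q4 → Q4 → Q3 → Set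
InM i u v m = dot₃ m (aL i u v) ≡ + 0

μ : Idx → Q4 → Q4 → Q4
μ one s w = s ⊛ conj w
μ two s w = conj s ⊛ w

data Span (G : Q3 → Set) : Q3 → Set where
  gen : ∀ {m} → G m → Span G m
  zer : Span G 0₃
  add : ∀ {m m'} → Span G m → Span G m' → Span G (m +₃ m')
  neg : ∀ {m} → Span G m → Span G (-₃ m)

-- Image of μ_i : L ⊗ L^⊥ → 𝐁₀(ℤ) (generated by images of pure tensors)
ImageMu : Idx → Q4 → Q4 → Q3 → Set
ImageMu i u v = Span (λ m → Σ Q4 λ s → Σ Q4 λ w →
  InL u v s × InPerp u v w × pure (μ i s w) ≡ m)

-- A homomorphism
-- P ⊗ P' → M is encoded (universal property) as a ℤ-bilinear map
-- P × P' → M; surjectivity means M is generated by its values.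

LegendreComposition : (P P' : Q4 → Set) (qP qP' : Q4 → ℤ)
                      (M : Q3 → Set) (qM : Q3 → ℤ) → Set
LegendreComposition P P' qP qP' M qM =
  Σ (Q4 → Q4 → Q3) λ β →
    (∀ s t → P s → P' t → M (β s t)) ×
    (∀ s s' t → P s → P s' → P' t → β (s +₄ s') t ≡ β s t +₃ β s' t) ×
    (∀ s t t' → P s → P' t → P' t' → β s (t +₄ t') ≡ β s t +₃ β s t') ×
    (∀ m → M m → Span (λ m' → Σ Q4 λ s → Σ Q4 λ t →
                         P s × P' t × β s t ≡ m') m) ×
    (∀ s t → P s → P' t → qP s * qP' t ≡ qM (β s t))

{-# OPTIONS --safe #-}

-- Identify ℤ⁴ with the Hamilton quaternions. For s ∈ L and w ∈ L^⊥ the real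
-- part of μᵢ(s ⊗ w) is ⟨s, w⟩ = 0, so μᵢ lands in 𝐁₀(ℤ), and multiplicativity
-- of the norm gives Q_L(s) Q_{L^⊥}(w) = Q_{Mᵢ}(μᵢ(s ⊗ w)). Expanding
-- ⟨μᵢ(s ⊗ w), aᵢ(L)⟩ for s = a u + b v exhibits it as a combination of ⟨w, u⟩
-- and ⟨w, v⟩, so the image lies in Mᵢ = aᵢ(L)^⊥; and Nr aᵢ(L) is the Gram
-- determinant Nr u Nr v − ⟨u, v⟩² = n ≠ 0. Conversely, for m ∈ Mᵢ the
-- vectors m̂̄ s (resp. s m̂) with s ∈ {u, v} lie in L^⊥ and show that Nr(u) m,
-- Nr(v) m and 2⟨u, v⟩ m lie in the image. These coefficients are coprime: a
-- common divisor is odd, because n + ⟨u, v⟩² ≢ 0 (mod 4) when n ≡ 1 (mod 4),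
-- hence divides ⟨u, v⟩, and its square then divides the squarefree n. By
-- Bézout, m itself lies in the image.
module Submission where

open import Defs
open import Data.Nat using (ℕ; _%_)
open import Data.Integer using (+_; -_; _*_)
open import Data.Product using (_×_)
open import Relation.Binary.PropositionalEquality using (_≡_; _≢_)

open import Data.Fin using (#_)
open import Data.Integer using (ℤ; _+_; _-_; -[1+_]; ∣_∣; -1ℤ)
import Data.Integer.Properties as ℤ
import Data.Integer.Tactic.RingSolver as ℤ-Solver
open ℤ-Solver using (solve-∀)
import Data.Nat as ℕ
import Data.Nat.Properties as ℕₚ
open import Data.Nat.Coprimality using (Coprime; coprime-divisor)
open import Data.Nat.DivMod using (m%n<n; %-distribˡ-+; %-distribˡ-*)
open import Data.Nat.Divisibility as ℕ∣ using (_∣_)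
open import Data.Nat.GCD using (gcd; gcd-GCD; gcd[m,n]∣m; gcd[m,n]∣n; module Bézout)
open import Data.Nat.Primality using (prime[2]; prime⇒irreducible)
open import Data.Product using (_,_; proj₁; proj₂)
open import Data.Sum using (inj₁; inj₂)
open import Data.List using (List; []; _∷_)
open import Data.Vec using (Vec; []; _∷_; _++_; concat; map)
open import Relation.Binary.PropositionalEquality
  using (refl; sym; trans; cong; cong₂; subst; module ≡-Reasoning)
open import Relation.Nullary using (¬_; contradiction)
import Tactic.RingSolver.NonReflective ℤ-Solver.ring as NonReflective
open NonReflective using (Expr; Κ; Ι; _⊕_; _⊗_; ⊝_)
open NonReflective.Ops using (prove) renaming (⟦_⟧ to ⟦_⟧ₑ; ⟦_⇓⟧ to ⟦_⇓⟧ₑ)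

q4-≡ : ∀ {p q} → re p ≡ re q → ii p ≡ ii q → jj p ≡ jj q → kk p ≡ kk q → p ≡ q
q4-≡ refl refl refl refl = refl

v3-≡ : ∀ {m m'} → x m ≡ x m' → y m ≡ y m' → z m ≡ z m' → m ≡ m'
v3-≡ refl refl refl = refl

infixr 7 _·₃_
_·₃_ : ℤ → Q3 → Q3
k ·₃ v3 a b c = v3 (k * a) (k * b) (k * c)

0₄ : Q4
0₄ = q4 (+ 0) (+ 0) (+ 0) (+ 0)

-- For m ∈ Mᵢ and s ∈ L, witness i m s lies in L^⊥ and μᵢ(s ⊗ witness i m s)
-- is Nr(s) m: writing m̂ = x i + y j + z k, one has s (m̂̄ s)̄ = s s̄ m̂ and
-- s̄ (s m̂) = s̄ s m̂.
witness : Idx → Q3 → Q4 → Q4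
witness one (v3 a b c) s = conj (q4 (+ 0) a b c) ⊛ s
witness two (v3 a b c) s = s ⊛ q4 (+ 0) a b c

-- The coordinate formulas of Defs transcribed into the solver's expression
-- syntax. At valuation (s ∷ t ∷ r ∷ []) (m ∷ n ∷ p ∷ []) (a ∷ b ∷ []) a
-- symbolic expression evaluates, definitionally, to the ℤ-expression it
-- transcribes, with S, T, R, M, N, P, A, B standing for s, t, r, m, n, p, a, b;
-- so each identity below is discharged by the solver's normal forms.
Poly : Set
Poly = Expr ℤ 23

record Q4ˢ : Set where
  constructor q4ˢ
  field
    reˢ iiˢ jjˢ kkˢ : Poly
open Q4ˢ

record Q3ˢ : Set where
  constructor v3ˢ
  field
    xˢ yˢ zˢ : Poly
open Q3ˢ

infixl 6 _⊖_ _+₄ˢ_ _+₃ˢ_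
_⊖_ : Poly → Poly → Poly
a ⊖ b = a ⊕ ⊝ b

_+₄ˢ_ : Q4ˢ → Q4ˢ → Q4ˢ
q4ˢ a b c d +₄ˢ q4ˢ a' b' c' d' = q4ˢ (a ⊕ a') (b ⊕ b') (c ⊕ c') (d ⊕ d')

_·₄ˢ_ : Poly → Q4ˢ → Q4ˢ
k ·₄ˢ q4ˢ a b c d = q4ˢ (k ⊗ a) (k ⊗ b) (k ⊗ c) (k ⊗ d)

_+₃ˢ_ : Q3ˢ → Q3ˢ → Q3ˢ
v3ˢ a b c +₃ˢ v3ˢ a' b' c' = v3ˢ (a ⊕ a') (b ⊕ b') (c ⊕ c')

_·₃ˢ_ : Poly → Q3ˢ → Q3ˢ
k ·₃ˢ v3ˢ a b c = v3ˢ (k ⊗ a) (k ⊗ b) (k ⊗ c)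

-₃ˢ_ : Q3ˢ → Q3ˢ
-₃ˢ v3ˢ a b c = v3ˢ (⊝ a) (⊝ b) (⊝ c)

dot₄ˢ : Q4ˢ → Q4ˢ → Poly
dot₄ˢ (q4ˢ a b c d) (q4ˢ a' b' c' d') = a ⊗ a' ⊕ b ⊗ b' ⊕ c ⊗ c' ⊕ d ⊗ d'

dot₃ˢ : Q3ˢ → Q3ˢ → Poly
dot₃ˢ (v3ˢ a b c) (v3ˢ a' b' c') = a ⊗ a' ⊕ b ⊗ b' ⊕ c ⊗ c'

nr₄ˢ : Q4ˢ → Poly
nr₄ˢ u = dot₄ˢ u u

nr₃ˢ : Q3ˢ → Poly
nr₃ˢ m = dot₃ˢ m m

conjˢ : Q4ˢ → Q4ˢ
conjˢ (q4ˢ a b c d) = q4ˢ a (⊝ b) (⊝ c) (⊝ d)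

_⊛ˢ_ : Q4ˢ → Q4ˢ → Q4ˢ
q4ˢ a₁ b₁ c₁ d₁ ⊛ˢ q4ˢ a₂ b₂ c₂ d₂ =
  q4ˢ (a₁ ⊗ a₂ ⊖ b₁ ⊗ b₂ ⊖ c₁ ⊗ c₂ ⊖ d₁ ⊗ d₂)
      (a₁ ⊗ b₂ ⊕ b₁ ⊗ a₂ ⊕ c₁ ⊗ d₂ ⊖ d₁ ⊗ c₂)
      (a₁ ⊗ c₂ ⊖ b₁ ⊗ d₂ ⊕ c₁ ⊗ a₂ ⊕ d₁ ⊗ b₂)
      (a₁ ⊗ d₂ ⊕ b₁ ⊗ c₂ ⊖ c₁ ⊗ b₂ ⊕ d₁ ⊗ a₂)

pureˢ : Q4ˢ → Q3ˢ
pureˢ (q4ˢ a b c d) = v3ˢ b c d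

aLˢ : Idx → Q4ˢ → Q4ˢ → Q3ˢ
aLˢ one u v = pureˢ (u ⊛ˢ conjˢ v)
aLˢ two u v = pureˢ (conjˢ v ⊛ˢ u)

μˢ : Idx → Q4ˢ → Q4ˢ → Q4ˢ
μˢ one s w = s ⊛ˢ conjˢ w
μˢ two s w = conjˢ s ⊛ˢ w

witnessˢ : Idx → Q3ˢ → Q4ˢ → Q4ˢ
witnessˢ one (v3ˢ a b c) s = conjˢ (q4ˢ (Κ (+ 0)) a b c) ⊛ˢ s
witnessˢ two (v3ˢ a b c) s = s ⊛ˢ q4ˢ (Κ (+ 0)) a b c

S T R : Q4ˢ
S = q4ˢ (Ι (# 0)) (Ι (# 1)) (Ι (# 2)) (Ι (# 3))
T = q4ˢ (Ι (# 4)) (Ι (# 5)) (Ι (# 6)) (Ι (# 7))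
R = q4ˢ (Ι (# 8)) (Ι (# 9)) (Ι (# 10)) (Ι (# 11))

M N P : Q3ˢ
M = v3ˢ (Ι (# 12)) (Ι (# 13)) (Ι (# 14))
N = v3ˢ (Ι (# 15)) (Ι (# 16)) (Ι (# 17))
P = v3ˢ (Ι (# 18)) (Ι (# 19)) (Ι (# 20))

A B : Poly
A = Ι (# 21)
B = Ι (# 22)

padded : ∀ {X : Set} n → X → List X → Vec X n
padded ℕ.zero    _ _        = []
padded (ℕ.suc n) d []       = d ∷ padded n d []
padded (ℕ.suc n) d (a ∷ as) = a ∷ padded n d as

valuation : List Q4 → List Q3 → List ℤ → Vec ℤ 23
valuation qs ms ks =
  concat (map (λ q → re q ∷ ii q ∷ jj q ∷ kk q ∷ []) (padded 3 0₄ qs)) ++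
  concat (map (λ m → x m ∷ y m ∷ z m ∷ []) (padded 3 0₃ ms)) ++ padded 2 (+ 0) ks

⟦_⟧₄ : Q4ˢ → Vec ℤ 23 → Q4
⟦ q4ˢ a b c d ⟧₄ σ = q4 (⟦ a ⟧ₑ σ) (⟦ b ⟧ₑ σ) (⟦ c ⟧ₑ σ) (⟦ d ⟧ₑ σ)

⟦_⟧₃ : Q3ˢ → Vec ℤ 23 → Q3
⟦ v3ˢ a b c ⟧₃ σ = v3 (⟦ a ⟧ₑ σ) (⟦ b ⟧ₑ σ) (⟦ c ⟧ₑ σ)

prove₄ : ∀ (σ : Vec ℤ 23) (e e' : Q4ˢ) →
  ⟦ reˢ e ⇓⟧ₑ σ ≡ ⟦ reˢ e' ⇓⟧ₑ σ → ⟦ iiˢ e ⇓⟧ₑ σ ≡ ⟦ iiˢ e' ⇓⟧ₑ σ →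
  ⟦ jjˢ e ⇓⟧ₑ σ ≡ ⟦ jjˢ e' ⇓⟧ₑ σ → ⟦ kkˢ e ⇓⟧ₑ σ ≡ ⟦ kkˢ e' ⇓⟧ₑ σ → ⟦ e ⟧₄ σ ≡ ⟦ e' ⟧₄ σ
prove₄ σ (q4ˢ a b c d) (q4ˢ a' b' c' d') pa pb pc pd =
  q4-≡ (prove σ a a' pa) (prove σ b b' pb) (prove σ c c' pc) (prove σ d d' pd)

prove₃ : ∀ (σ : Vec ℤ 23) (e e' : Q3ˢ) →
  ⟦ xˢ e ⇓⟧ₑ σ ≡ ⟦ xˢ e' ⇓⟧ₑ σ → ⟦ yˢ e ⇓⟧ₑ σ ≡ ⟦ yˢ e' ⇓⟧ₑ σ → ⟦ zˢ e ⇓⟧ₑ σ ≡ ⟦ zˢ e' ⇓⟧ₑ σ →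
  ⟦ e ⟧₃ σ ≡ ⟦ e' ⟧₃ σ
prove₃ σ (v3ˢ a b c) (v3ˢ a' b' c') pa pb pc =
  v3-≡ (prove σ a a' pa) (prove σ b b' pb) (prove σ c c' pc)

·₃-identityˡ : ∀ m → + 1 ·₃ m ≡ m
·₃-identityˡ m = prove₃ (valuation [] (m ∷ []) []) (Κ (+ 1) ·₃ˢ M) M refl refl refl

·₃-zeroˡ : ∀ m → + 0 ·₃ m ≡ 0₃
·₃-zeroˡ m = refl

·₃-distribʳ-+ : ∀ p q m → (p + q) ·₃ m ≡ p ·₃ m +₃ q ·₃ m
·₃-distribʳ-+ p q m =
  prove₃ (valuation [] (m ∷ []) (p ∷ q ∷ [])) ((A ⊕ B) ·₃ˢ M) (A ·₃ˢ M +₃ˢ B ·₃ˢ M) refl refl refl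

·₃-assoc : ∀ p q m → p ·₃ (q ·₃ m) ≡ (p * q) ·₃ m
·₃-assoc p q m =
  prove₃ (valuation [] (m ∷ []) (p ∷ q ∷ [])) (A ·₃ˢ (B ·₃ˢ M)) ((A ⊗ B) ·₃ˢ M) refl refl refl

-₃-·₃ : ∀ k m → -₃ (k ·₃ m) ≡ (- k) ·₃ m
-₃-·₃ k m = prove₃ (valuation [] (m ∷ []) (k ∷ [])) (-₃ˢ (A ·₃ˢ M)) ((⊝ A) ·₃ˢ M) refl refl refl

dot₃-zeroˡ : ∀ a → dot₃ 0₃ a ≡ + 0
dot₃-zeroˡ a = refl

dot₃-distribʳ-+₃ : ∀ m m' a → dot₃ (m +₃ m') a ≡ dot₃ m a + dot₃ m' a
dot₃-distribʳ-+₃ m m' a =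
  prove (valuation [] (m ∷ m' ∷ a ∷ []) []) (dot₃ˢ (M +₃ˢ N) P) (dot₃ˢ M P ⊕ dot₃ˢ N P) refl

dot₃-negˡ : ∀ m a → dot₃ (-₃ m) a ≡ - dot₃ m a
dot₃-negˡ m a = prove (valuation [] (m ∷ a ∷ []) []) (dot₃ˢ (-₃ˢ M) N) (⊝ dot₃ˢ M N) refl

dot₄-comm : ∀ s t → dot₄ s t ≡ dot₄ t s
dot₄-comm s t = prove (valuation (s ∷ t ∷ []) [] []) (dot₄ˢ S T) (dot₄ˢ T S) refl

⊛-distribʳ-+₄ : ∀ s s' t → (s +₄ s') ⊛ t ≡ s ⊛ t +₄ s' ⊛ t
⊛-distribʳ-+₄ s s' t =
  prove₄ (valuation (s ∷ s' ∷ t ∷ []) [] []) ((S +₄ˢ T) ⊛ˢ R) (S ⊛ˢ R +₄ˢ T ⊛ˢ R)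
         refl refl refl refl

⊛-distribˡ-+₄ : ∀ s t t' → s ⊛ (t +₄ t') ≡ s ⊛ t +₄ s ⊛ t'
⊛-distribˡ-+₄ s t t' =
  prove₄ (valuation (s ∷ t ∷ t' ∷ []) [] []) (S ⊛ˢ (T +₄ˢ R)) (S ⊛ˢ T +₄ˢ S ⊛ˢ R)
         refl refl refl refl

conj-+₄ : ∀ s s' → conj (s +₄ s') ≡ conj s +₄ conj s'
conj-+₄ s s' =
  prove₄ (valuation (s ∷ s' ∷ []) [] []) (conjˢ (S +₄ˢ T)) (conjˢ S +₄ˢ conjˢ T) refl refl refl refl

nr₄-⊛ : ∀ p q → nr₄ (p ⊛ q) ≡ nr₄ p * nr₄ q
nr₄-⊛ p q = prove (valuation (p ∷ q ∷ []) [] []) (nr₄ˢ (S ⊛ˢ T)) (nr₄ˢ S ⊗ nr₄ˢ T) refl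

nr₄-conj : ∀ p → nr₄ (conj p) ≡ nr₄ p
nr₄-conj p = prove (valuation (p ∷ []) [] []) (nr₄ˢ (conjˢ S)) (nr₄ˢ S) refl

nr₄≡nr₃-pure+re² : ∀ p → nr₄ p ≡ nr₃ (pure p) + re p * re p
nr₄≡nr₃-pure+re² p =
  prove (valuation (p ∷ []) [] []) (nr₄ˢ S) (nr₃ˢ (pureˢ S) ⊕ reˢ S ⊗ reˢ S) refl

nr₃-aL : ∀ i u v → nr₃ (aL i u v) ≡ nr₄ u * nr₄ v - dot₄ u v * dot₄ u v
nr₃-aL one = λ u v → prove (valuation (u ∷ v ∷ []) [] []) (nr₃ˢ (aLˢ one S T))
                       (nr₄ˢ S ⊗ nr₄ˢ T ⊖ dot₄ˢ S T ⊗ dot₄ˢ S T) refl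
nr₃-aL two = λ u v → prove (valuation (u ∷ v ∷ []) [] []) (nr₃ˢ (aLˢ two S T))
                       (nr₄ˢ S ⊗ nr₄ˢ T ⊖ dot₄ˢ S T ⊗ dot₄ˢ S T) refl

re-μ : ∀ i s t → re (μ i s t) ≡ dot₄ s t
re-μ one = λ s t → prove (valuation (s ∷ t ∷ []) [] []) (reˢ (μˢ one S T)) (dot₄ˢ S T) refl
re-μ two = λ s t → prove (valuation (s ∷ t ∷ []) [] []) (reˢ (μˢ two S T)) (dot₄ˢ S T) refl

∈L-left : ∀ u v → InL u v u
∈L-left u v = + 1 , + 0 ,
  prove₄ (valuation (u ∷ v ∷ []) [] []) S (Κ (+ 1) ·₄ˢ S +₄ˢ Κ (+ 0) ·₄ˢ T) refl refl refl refl

∈L-right : ∀ u v → InL u v v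
∈L-right u v = + 0 , + 1 ,
  prove₄ (valuation (u ∷ v ∷ []) [] []) T (Κ (+ 0) ·₄ˢ S +₄ˢ Κ (+ 1) ·₄ˢ T) refl refl refl refl

μ₁-pairing-aL : ∀ u v w a b → let s = a ·₄ u +₄ b ·₄ v in
  dot₃ (pure (μ one s w)) (aL one u v) ≡ dot₄ s u * dot₄ w v - dot₄ s v * dot₄ w u
μ₁-pairing-aL u v w a b =
  prove (valuation (u ∷ v ∷ w ∷ []) [] (a ∷ b ∷ []))
        (dot₃ˢ (pureˢ (μˢ one s R)) (aLˢ one S T))
        (dot₄ˢ s S ⊗ dot₄ˢ R T ⊖ dot₄ˢ s T ⊗ dot₄ˢ R S) refl
  where
  s : Q4ˢ
  s = A ·₄ˢ S +₄ˢ B ·₄ˢ T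

μ₂-pairing-aL : ∀ u v w a b → let s = a ·₄ u +₄ b ·₄ v in
  dot₃ (pure (μ two s w)) (aL two u v) ≡ dot₄ s v * dot₄ w u - dot₄ s u * dot₄ w v
μ₂-pairing-aL u v w a b =
  prove (valuation (u ∷ v ∷ w ∷ []) [] (a ∷ b ∷ []))
        (dot₃ˢ (pureˢ (μˢ two s R)) (aLˢ two S T))
        (dot₄ˢ s T ⊗ dot₄ˢ R S ⊖ dot₄ˢ s S ⊗ dot₄ˢ R T) refl
  where
  s : Q4ˢ
  s = A ·₄ˢ S +₄ˢ B ·₄ˢ T

witness₁-pairing : ∀ m u v a b →
  dot₄ (witness one m u) (a ·₄ u +₄ b ·₄ v) ≡ b * dot₃ m (aL one u v) ×
  dot₄ (witness one m v) (a ·₄ u +₄ b ·₄ v) ≡ - a * dot₃ m (aL one u v)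
witness₁-pairing m u v a b =
  prove σ (dot₄ˢ (witnessˢ one M S) s) (B ⊗ dot₃ˢ M (aLˢ one S T)) refl ,
  prove σ (dot₄ˢ (witnessˢ one M T) s) (⊝ A ⊗ dot₃ˢ M (aLˢ one S T)) refl
  where
  σ : Vec ℤ 23
  σ = valuation (u ∷ v ∷ []) (m ∷ []) (a ∷ b ∷ [])
  s : Q4ˢ
  s = A ·₄ˢ S +₄ˢ B ·₄ˢ T

witness₂-pairing : ∀ m u v a b →
  dot₄ (witness two m u) (a ·₄ u +₄ b ·₄ v) ≡ - b * dot₃ m (aL two u v) ×
  dot₄ (witness two m v) (a ·₄ u +₄ b ·₄ v) ≡ a * dot₃ m (aL two u v)
witness₂-pairing m u v a b =
  prove σ (dot₄ˢ (witnessˢ two M S) s) (⊝ B ⊗ dot₃ˢ M (aLˢ two S T)) refl ,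
  prove σ (dot₄ˢ (witnessˢ two M T) s) (A ⊗ dot₃ˢ M (aLˢ two S T)) refl
  where
  σ : Vec ℤ 23
  σ = valuation (u ∷ v ∷ []) (m ∷ []) (a ∷ b ∷ [])
  s : Q4ˢ
  s = A ·₄ˢ S +₄ˢ B ·₄ˢ T

μ-witness-diag : ∀ i m s → pure (μ i s (witness i m s)) ≡ nr₄ s ·₃ m
μ-witness-diag one = λ m s → prove₃ (valuation (s ∷ []) (m ∷ []) [])
  (pureˢ (μˢ one S (witnessˢ one M S))) (nr₄ˢ S ·₃ˢ M) refl refl refl
μ-witness-diag two = λ m s → prove₃ (valuation (s ∷ []) (m ∷ []) [])
  (pureˢ (μˢ two S (witnessˢ two M S))) (nr₄ˢ S ·₃ˢ M) refl refl refl

μ-witness-cross : ∀ i m s t →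
  pure (μ i s (witness i m t)) +₃ pure (μ i t (witness i m s)) ≡ (+ 2 * dot₄ s t) ·₃ m
μ-witness-cross one = λ m s t → prove₃ (valuation (s ∷ t ∷ []) (m ∷ []) [])
  (pureˢ (μˢ one S (witnessˢ one M T)) +₃ˢ pureˢ (μˢ one T (witnessˢ one M S)))
  ((Κ (+ 2) ⊗ dot₄ˢ S T) ·₃ˢ M) refl refl refl
μ-witness-cross two = λ m s t → prove₃ (valuation (s ∷ t ∷ []) (m ∷ []) [])
  (pureˢ (μˢ two S (witnessˢ two M T)) +₃ˢ pureˢ (μˢ two T (witnessˢ two M S)))
  ((Κ (+ 2) ⊗ dot₄ˢ S T) ·₃ˢ M) refl refl refl

nr₄-μ : ∀ i s t → nr₄ (μ i s t) ≡ nr₄ s * nr₄ t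
nr₄-μ one s t = trans (nr₄-⊛ s (conj t)) (cong (nr₄ s *_) (nr₄-conj t))
nr₄-μ two s t = trans (nr₄-⊛ (conj s) t) (cong (_* nr₄ t) (nr₄-conj s))

μ-distribʳ-+₄ : ∀ i s s' t → pure (μ i (s +₄ s') t) ≡ pure (μ i s t) +₃ pure (μ i s' t)
μ-distribʳ-+₄ one s s' t = cong pure (⊛-distribʳ-+₄ s s' (conj t))
μ-distribʳ-+₄ two s s' t = begin
  pure (conj (s +₄ s') ⊛ t)       ≡⟨ cong (λ c → pure (c ⊛ t)) (conj-+₄ s s') ⟩
  pure ((conj s +₄ conj s') ⊛ t)  ≡⟨ cong pure (⊛-distribʳ-+₄ (conj s) (conj s') t) ⟩
  pure (conj s ⊛ t +₄ conj s' ⊛ t) ∎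
  where open ≡-Reasoning

μ-distribˡ-+₄ : ∀ i s t t' → pure (μ i s (t +₄ t')) ≡ pure (μ i s t) +₃ pure (μ i s t')
μ-distribˡ-+₄ one s t t' = begin
  pure (s ⊛ conj (t +₄ t'))         ≡⟨ cong (λ c → pure (s ⊛ c)) (conj-+₄ t t') ⟩
  pure (s ⊛ (conj t +₄ conj t'))    ≡⟨ cong pure (⊛-distribˡ-+₄ s (conj t) (conj t')) ⟩
  pure (s ⊛ conj t +₄ s ⊛ conj t') ∎
  where open ≡-Reasoning
μ-distribˡ-+₄ two s t t' = cong pure (⊛-distribˡ-+₄ (conj s) t t')

μ-re-⊥ : ∀ i {u v s t} → InL u v s → InPerp u v t → re (μ i s t) ≡ + 0
μ-re-⊥ i {s = s} {t} s∈L t⊥L = trans (re-μ i s t) (trans (dot₄-comm s t) (t⊥L s s∈L))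

x*p-y*q≡0 : ∀ x y {p q} → p ≡ + 0 → q ≡ + 0 → x * p - y * q ≡ + 0
x*p-y*q≡0 x y refl refl = cong₂ _-_ (ℤ.*-zeroʳ x) (ℤ.*-zeroʳ y)

μ-InM : ∀ i {u v s w} → InL u v s → InPerp u v w → InM i u v (pure (μ i s w))
μ-InM one {u} {v} {s} {w} (a , b , refl) w⊥L =
  trans (μ₁-pairing-aL u v w a b)
        (x*p-y*q≡0 (dot₄ s u) (dot₄ s v) (w⊥L v (∈L-right u v)) (w⊥L u (∈L-left u v)))
μ-InM two {u} {v} {s} {w} (a , b , refl) w⊥L =
  trans (μ₂-pairing-aL u v w a b)
        (x*p-y*q≡0 (dot₄ s v) (dot₄ s u) (w⊥L u (∈L-left u v)) (w⊥L v (∈L-right u v)))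

Span-orthogonal : ∀ {G} a → (∀ {m} → G m → dot₃ m a ≡ + 0) → ∀ {m} → Span G m → dot₃ m a ≡ + 0
Span-orthogonal a G⊥a (gen g) = G⊥a g
Span-orthogonal a G⊥a zer = dot₃-zeroˡ a
Span-orthogonal a G⊥a (add {m} {m'} p q) =
  trans (dot₃-distribʳ-+₃ m m' a) (cong₂ _+_ (Span-orthogonal a G⊥a p) (Span-orthogonal a G⊥a q))
Span-orthogonal a G⊥a (neg {m} p) = trans (dot₃-negˡ m a) (cong -_ (Span-orthogonal a G⊥a p))

ImageMu⇒InM : ∀ i {u v m} → ImageMu i u v m → InM i u v m
ImageMu⇒InM i {u} {v} = Span-orthogonal (aL i u v) λ where
  (s , w , s∈L , w⊥L , refl) → μ-InM i s∈L w⊥L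

⊥L-of-multiple-pairing : ∀ {u v c} w (k : ℤ → ℤ → ℤ) →
  (∀ a b → dot₄ w (a ·₄ u +₄ b ·₄ v) ≡ k a b * c) → c ≡ + 0 → InPerp u v w
⊥L-of-multiple-pairing w k pairing refl _ (a , b , refl) =
  trans (pairing a b) (ℤ.*-zeroʳ (k a b))

witness-⊥L : ∀ i {u v m} → InM i u v m → InPerp u v (witness i m u) × InPerp u v (witness i m v)
witness-⊥L one {u} {v} {m} m∈M =
  ⊥L-of-multiple-pairing (witness one m u) (λ _ b → b)
    (λ a b → proj₁ (witness₁-pairing m u v a b)) m∈M ,
  ⊥L-of-multiple-pairing (witness one m v) (λ a _ → - a)
    (λ a b → proj₂ (witness₁-pairing m u v a b)) m∈M
witness-⊥L two {u} {v} {m} m∈M =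
  ⊥L-of-multiple-pairing (witness two m u) (λ _ b → - b)
    (λ a b → proj₁ (witness₂-pairing m u v a b)) m∈M ,
  ⊥L-of-multiple-pairing (witness two m v) (λ a _ → a)
    (λ a b → proj₂ (witness₂-pairing m u v a b)) m∈M

gram-multiples-in-image : ∀ i {u v m} → InM i u v m →
  ImageMu i u v (nr₄ u ·₃ m) × ImageMu i u v (nr₄ v ·₃ m) ×
  ImageMu i u v ((+ 2 * dot₄ u v) ·₃ m)
gram-multiples-in-image i {u} {v} {m} m∈M =
  subst (ImageMu i u v) (μ-witness-diag i m u) (image (∈L-left u v) wu⊥L) ,
  subst (ImageMu i u v) (μ-witness-diag i m v) (image (∈L-right u v) wv⊥L) ,
  subst (ImageMu i u v) (μ-witness-cross i m u v)
        (add (image (∈L-left u v) wv⊥L) (image (∈L-right u v) wu⊥L))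
  where
  wu⊥L : InPerp u v (witness i m u)
  wu⊥L = proj₁ (witness-⊥L i m∈M)
  wv⊥L : InPerp u v (witness i m v)
  wv⊥L = proj₂ (witness-⊥L i m∈M)
  image : ∀ {s w} → InL u v s → InPerp u v w → ImageMu i u v (pure (μ i s w))
  image s∈L w⊥L = gen (_ , _ , s∈L , w⊥L , refl)

Span-+·₃ : ∀ {G m} k → Span G m → Span G (+ k ·₃ m)
Span-+·₃ {G} {m} ℕ.zero _ = subst (Span G) (sym (·₃-zeroˡ m)) zer
Span-+·₃ {G} {m} (ℕ.suc k) p =
  subst (Span G) (sym (trans (·₃-distribʳ-+ (+ 1) (+ k) m) (cong (_+₃ + k ·₃ m) (·₃-identityˡ m))))
        (add p (Span-+·₃ k p))

Span-·₃ : ∀ {G m} k → Span G m → Span G (k ·₃ m)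
Span-·₃ (+ k) p = Span-+·₃ k p
Span-·₃ {G} {m} -[1+ k ] p = subst (Span G) (-₃-·₃ (+ ℕ.suc k) m) (neg (Span-+·₃ (ℕ.suc k) p))

module _ {G : Q3 → Set} (m : Q3) where

  Span-multiple-+ : ∀ {p q} → Span G (p ·₃ m) → Span G (q ·₃ m) → Span G ((p + q) ·₃ m)
  Span-multiple-+ {p} {q} hp hq = subst (Span G) (sym (·₃-distribʳ-+ p q m)) (add hp hq)

  Span-multiple-* : ∀ {p} k → Span G (p ·₃ m) → Span G ((k * p) ·₃ m)
  Span-multiple-* {p} k hp = subst (Span G) (·₃-assoc k p m) (Span-·₃ k hp)

[x+y]-y≡x : ∀ x y → x + y - y ≡ x
[x+y]-y≡x = solve-∀

[x-y]+y≡x : ∀ x y → x - y + y ≡ x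
[x-y]+y≡x = solve-∀

Bézout-in-ℤ : ∀ {d m n} x y → d ℕ.+ y ℕ.* n ≡ x ℕ.* m → + x * + m - + y * + n ≡ + d
Bézout-in-ℤ {d} {m} {n} x y eq = begin
  + x * + m - + y * + n              ≡⟨ cong₂ _-_ (sym (ℤ.pos-* x m)) (sym (ℤ.pos-* y n)) ⟩
  + (x ℕ.* m) - + (y ℕ.* n)          ≡⟨ cong (λ k → + k - + (y ℕ.* n)) (sym eq) ⟩
  + (d ℕ.+ y ℕ.* n) - + (y ℕ.* n)    ≡⟨ cong (_- + (y ℕ.* n)) (ℤ.pos-+ d (y ℕ.* n)) ⟩
  + d + + (y ℕ.* n) - + (y ℕ.* n)    ≡⟨ [x+y]-y≡x (+ d) (+ (y ℕ.* n)) ⟩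
  + d                                ∎
  where open ≡-Reasoning

module ℤ-Ideal (I : ℤ → Set)
  (+-closed : ∀ {p q} → I p → I q → I (p + q))
  (*-closed : ∀ {p} k → I p → I (k * p)) where

  neg-closed : ∀ {k} → I k → I (- k)
  neg-closed {k} h = subst I (ℤ.-1*i≡-i k) (*-closed -1ℤ h)

  abs-closed : ∀ {k} → I k → I (+ ∣ k ∣)
  abs-closed {+ _}       h = h
  abs-closed { -[1+ _ ]} h = neg-closed h

  Bézout-closed : ∀ {d m n} x y → d ℕ.+ y ℕ.* n ≡ x ℕ.* m → I (+ m) → I (+ n) → I (+ d)
  Bézout-closed x y eq hm hn =
    subst I (Bézout-in-ℤ x y eq) (+-closed (*-closed (+ x) hm) (neg-closed (*-closed (+ y) hn)))

  gcd-closed : ∀ {m n} → I (+ m) → I (+ n) → I (+ gcd m n)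
  gcd-closed {m} {n} hm hn with Bézout.identity (gcd-GCD m n)
  ... | Bézout.+- x y eq = Bézout-closed x y eq hm hn
  ... | Bézout.-+ x y eq = Bézout-closed y x eq hn hm

1+r²≢0-mod-4 : ∀ r → r ℕ.< 4 → (1 ℕ.+ (r ℕ.* r) % 4) % 4 ≢ 0
1+r²≢0-mod-4 0 _ ()
1+r²≢0-mod-4 1 _ ()
1+r²≢0-mod-4 2 _ ()
1+r²≢0-mod-4 3 _ ()
1+r²≢0-mod-4 (ℕ.suc (ℕ.suc (ℕ.suc (ℕ.suc _)))) (ℕ.s≤s (ℕ.s≤s (ℕ.s≤s (ℕ.s≤s ()))))

¬4∣1-mod-4+square : ∀ {n} D → n % 4 ≡ 1 → ¬ 4 ∣ n ℕ.+ D ℕ.* D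
¬4∣1-mod-4+square {n} D n≡1 4∣ = 1+r²≢0-mod-4 (D % 4) (m%n<n D 4) (begin
  (1 ℕ.+ (D % 4 ℕ.* (D % 4)) % 4) % 4   ≡⟨ cong₂ (λ a b → (a ℕ.+ b) % 4)
                                                 (sym n≡1) (sym (%-distribˡ-* D D 4)) ⟩
  (n % 4 ℕ.+ (D ℕ.* D) % 4) % 4         ≡⟨ sym (%-distribˡ-+ n (D ℕ.* D) 4) ⟩
  (n ℕ.+ D ℕ.* D) % 4                   ≡⟨ ℕ∣.n∣m⇒m%n≡0 _ 4 4∣ ⟩
  0                                     ∎)
  where open ≡-Reasoning

odd⇒coprime-2 : ∀ {g} → ¬ 2 ∣ g → Coprime g 2
odd⇒coprime-2 2∤g (d∣g , d∣2) with prime⇒irreducible prime[2] d∣2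
... | inj₁ d≡1 = d≡1
... | inj₂ refl = contradiction d∣g 2∤g

common-divisor≡1 : ∀ {n A B D g} → n % 4 ≡ 1 → SquareFree n → A ℕ.* B ≡ n ℕ.+ D ℕ.* D →
  g ∣ A → g ∣ B → g ∣ 2 ℕ.* D → g ≡ 1
common-divisor≡1 {n} {A} {B} {D} {g} n≡1 squarefree AB≡n+D² g∣A g∣B g∣2D = squarefree g g²∣n
  where
  g-odd : ¬ 2 ∣ g
  g-odd 2∣g = ¬4∣1-mod-4+square D n≡1
    (subst (4 ∣_) AB≡n+D² (ℕ∣.*-pres-∣ (ℕ∣.∣-trans 2∣g g∣A) (ℕ∣.∣-trans 2∣g g∣B)))
  g∣D : g ∣ D
  g∣D = coprime-divisor (odd⇒coprime-2 g-odd) g∣2D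
  g²∣n : g ℕ.* g ∣ n
  g²∣n = ℕ∣.∣m+n∣m⇒∣n
    (subst (g ℕ.* g ∣_) (trans AB≡n+D² (ℕₚ.+-comm n (D ℕ.* D))) (ℕ∣.*-pres-∣ g∣A g∣B))
    (ℕ∣.*-pres-∣ g∣D g∣D)

square≡∣∣² : ∀ d → d * d ≡ + (∣ d ∣ ℕ.* ∣ d ∣)
square≡∣∣² (+ k)    = sym (ℤ.pos-* k k)
square≡∣∣² -[1+ k ] = refl

gram-in-ℕ : ∀ {A B d n} → A * B - d * d ≡ + n → ∣ A ∣ ℕ.* ∣ B ∣ ≡ n ℕ.+ ∣ d ∣ ℕ.* ∣ d ∣
gram-in-ℕ {A} {B} {d} {n} gram = begin
  ∣ A ∣ ℕ.* ∣ B ∣                    ≡⟨ sym (ℤ.abs-* A B) ⟩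
  ∣ A * B ∣                          ≡⟨ cong ∣_∣ (sym ([x-y]+y≡x (A * B) (d * d))) ⟩
  ∣ (A * B - d * d) + d * d ∣        ≡⟨ cong₂ (λ p q → ∣ p + q ∣) gram (square≡∣∣² d) ⟩
  ∣ + n + + (∣ d ∣ ℕ.* ∣ d ∣) ∣      ≡⟨ cong ∣_∣ (sym (ℤ.pos-+ n (∣ d ∣ ℕ.* ∣ d ∣))) ⟩
  n ℕ.+ ∣ d ∣ ℕ.* ∣ d ∣              ∎
  where open ≡-Reasoning

InM⇒ImageMu : ∀ i {u v m n} → n % 4 ≡ 1 → SquareFree n →
  nr₄ u * nr₄ v - dot₄ u v * dot₄ u v ≡ + n → InM i u v m → ImageMu i u v m
InM⇒ImageMu i {u} {v} {m} n≡1 squarefree gram m∈M =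
  subst (ImageMu i u v) (·₃-identityˡ m) (subst Multiple (cong +_ g≡1) g·m∈image)
  where
  Multiple : ℤ → Set
  Multiple k = ImageMu i u v (k ·₃ m)
  open ℤ-Ideal Multiple (λ {p} {q} → Span-multiple-+ m {p} {q})
                        (λ {p} → Span-multiple-* m {p})

  α β γ : ℕ
  α = ∣ nr₄ u ∣
  β = ∣ nr₄ v ∣
  γ = ∣ + 2 * dot₄ u v ∣
  g : ℕ
  g = gcd (gcd α β) γ

  g·m∈image : Multiple (+ g)
  g·m∈image with gram-multiples-in-image i m∈M
  ... | Au , Bv , Cuv =
    gcd-closed {gcd α β} {γ} (gcd-closed {α} {β} (abs-closed {nr₄ u} Au) (abs-closed {nr₄ v} Bv))
                             (abs-closed {+ 2 * dot₄ u v} Cuv)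

  g≡1 : g ≡ 1
  g≡1 = common-divisor≡1 {A = α} {β} {∣ dot₄ u v ∣} n≡1 squarefree
    (gram-in-ℕ {nr₄ u} {nr₄ v} {dot₄ u v} gram)
    (ℕ∣.∣-trans (gcd[m,n]∣m (gcd α β) γ) (gcd[m,n]∣m α β))
    (ℕ∣.∣-trans (gcd[m,n]∣m (gcd α β) γ) (gcd[m,n]∣n α β))
    (subst (g ∣_) (ℤ.abs-* (+ 2) (dot₄ u v)) (gcd[m,n]∣n (gcd α β) γ))

legendre-composition : ∀ i {u v} → (∀ m → InM i u v m → ImageMu i u v m) →
  LegendreComposition (InL u v) (InPerp u v) nr₄ nr₄ (InM i u v) nr₃
legendre-composition i {u} {v} M⊆image =
  (λ s t → pure (μ i s t)) ,
  (λ _ _ → μ-InM i) ,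
  (λ s s' t _ _ _ → μ-distribʳ-+₄ i s s' t) ,
  (λ s t t' _ _ _ → μ-distribˡ-+₄ i s t t') ,
  M⊆image ,
  nr-multiplicative
  where
  nr-multiplicative : ∀ s t → InL u v s → InPerp u v t → nr₄ s * nr₄ t ≡ nr₃ (pure (μ i s t))
  nr-multiplicative s t s∈L t⊥L = begin
    nr₄ s * nr₄ t                     ≡⟨ sym (nr₄-μ i s t) ⟩
    nr₄ μst                           ≡⟨ nr₄≡nr₃-pure+re² μst ⟩
    nr₃ (pure μst) + re μst * re μst  ≡⟨ cong (λ r → nr₃ (pure μst) + r * r) (μ-re-⊥ i s∈L t⊥L) ⟩
    nr₃ (pure μst) + + 0              ≡⟨ ℤ.+-identityʳ _ ⟩
    nr₃ (pure μst)                    ∎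
    where
    open ≡-Reasoning
    μst : Q4
    μst = μ i s t

theorem7p4 : (n : ℕ) → InD n → SquareFree n → n % 4 ≡ 1 →
    (u v : Q4) → Primitive u v → disc u v ≡ - (+ 4) * (+ n) →
    (i : Idx) →
      -- μ_i lands in 𝐁₀(ℤ)
      (∀ s w → InL u v s → InPerp u v w → re (μ i s w) ≡ + 0) ×
      -- M_i is two-dimensional (a_i(L) ≠ 0)
      aL i u v ≢ v3 (+ 0) (+ 0) (+ 0) ×
      -- image of μ_i equals M_i
      (∀ m → ImageMu i u v m → InM i u v m) ×
      (∀ m → InM i u v m → ImageMu i u v m) ×
      -- (M_i , Q_{M_i}) is a Legendre composition of (L , Q_L), (L^⊥ , Q_{L^⊥})
      LegendreComposition (InL u v) (InPerp u v) nr₄ nr₄ (InM i u v) nr₃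
theorem7p4 n _ squarefree n≡1 u v _ disc≡-4n i =
  (λ _ _ → μ-re-⊥ i) , aL≢0 , (λ _ → ImageMu⇒InM i) , M⊆image , legendre-composition i M⊆image
  where
  gram : nr₄ u * nr₄ v - dot₄ u v * dot₄ u v ≡ + n
  gram = ℤ.*-cancelˡ-≡ (- + 4) _ _ disc≡-4n

  aL≢0 : aL i u v ≢ v3 (+ 0) (+ 0) (+ 0)
  aL≢0 aL≡0 = contradiction (trans (cong (_% 4) (sym n≡0)) n≡1) λ ()
    where
    n≡0 : n ≡ 0
    n≡0 = ℤ.+-injective (trans (sym gram) (trans (sym (nr₃-aL i u v)) (cong nr₃ aL≡0)))

  M⊆image : ∀ m → InM i u v m → ImageMu i u v m
  M⊆image _ = InM⇒ImageMu i n≡1 squarefree gram
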